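{- Let $G\in\mathcal{F}_{3s}(n)$. (i) $G$ admits a (6)-distinguishing total coloring, and $\chi''_{(6)}(G)\ge \chi''_{\lambda}(G)$ for every $\lambda\in\{(s),(as),s,as,2s,2as\}$. (ii) If $G$ admits an (8)-distinguishing total coloring, then $\chi''_{(8)}(G)\ge \chi''_{\varepsilon}(G)$ for every $\varepsilon\in\{(s),(as),\langle s\rangle,\langle as\rangle,s,as,2s,2as\}$, and moreover $$\chi''_{(8)}(G)\le \min\{\chi'_s(G)+\chi''_{\langle s\rangle}(G),\ \chi''_{(s)}(G)+\chi''_{\langle s\rangle}(G)\}.$$
   Context: All graphs are finite, simple and undirected. $\mathcal{F}_{3s}(n)$ denotes the set of simple graphs with $n\ge 3$ vertices, no isolated edges and at most one isolated vertex. $N(u)$ is the set of neighbours and $N_e(u)$ the set of incident edges of $u$. A proper total $k$-coloring of $G$ is a map $f:V(G)\cup E(G)\to\{1,\dots,k\}$ such that adjacent vertices receive distinct colors, edges sharing an end receive distinct colors, and each edge receives a color distinct from the colors of its two ends. Put $C(f,u)=\{f(e):e\in N_e(u)\}$, $C\langle f,u\rangle=\{f(x):x\in N(u)\}\cup\{f(u)\}$, $C[f,u]=C(f,u)\cup\{f(u)\}$, $N_2[f,u]=C(f,u)\cup C\langle f,u\rangle$. Conditions: (C1) $C(f,u)\ne C(f,v)$ for distinct vertices $u,v$; (C2) $C(f,x)\ne C(f,y)$ for every edge $xy$; (C3) $C\langle f,u\rangle\ne C\langle f,v\rangle$ for distinct $u,v$; (C4) $C\langle f,x\rangle\ne C\langle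 f,y\rangle$ for every edge $xy$; (C5) $C[f,u]\ne C[f,v]$ for distinct $u,v$; (C6) $C[f,x]\ne C[f,y]$ for every edge $xy$; (C7) $N_2[f,u]\ne N_2[f,v]$ for distinct $u,v$; (C8) $N_2[f,x]\ne N_2[f,y]$ for every edge $xy$. For $G\in\mathcal{F}_{3s}(n)$, $\chi''_{(s)},\chi''_{(as)},\chi''_{\langle s\rangle},\chi''_{\langle as\rangle},\chi''_{s},\chi''_{as},\chi''_{2s},\chi''_{2as}$ denote the least $k$ such that $G$ has a proper total $k$-coloring satisfying (C1), (C2), (C3), (C4), (C5), (C6), (C7), (C8) respectively. An (8)-distinguishing total coloring is a proper total coloring satisfying all of (C1)–(C8), and $\chi''_{(8)}(G)$ is the least $k$ for which one with $k$ colors exists; a (6)-distinguishing total coloring is a proper total coloring satisfying (C1),(C2),(C5),(C6),(C7),(C8), and $\chi''_{(6)}(G)$ is the least such $k$. $\chi'_s(G)$ is the least number of colors in a proper edge coloring in which the sets of colors on edges incident to $u$ and to $v$ differ for all distinct vertices $u,v$. -}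

module Defs where

open import Data.Nat using (ℕ; _≤_; _+_; _⊓_)
open import Data.Fin using (Fin)
open import Data.Bool using (Bool; true; false)
open import Data.Product using (Σ; _×_; ∃; ∃-syntax; _,_)
open import Data.Sum using (_⊎_)
open import Data.List using (List; _∷_; [])
open import Relation.Binary.PropositionalEquality using (_≡_; _≢_)
open import Relation.Nullary using (¬_)

record Graph (n : ℕ) : Set where
  field
    E     : Fin n → Fin n → Bool
    sym   : ∀ u v → E u v ≡ E v u
    irrefl : ∀ u → E u u ≡ false

  Adj : Fin n → Fin n → Set
  Adj u v = E u v ≡ true

open Graph public

Isolated : ∀ {n} → Graph n → Fin n → Set
Isolated G u = ∀ v → ¬ Adj G u v

IsolatedEdge : ∀ {n} → Graph n → Fin n → Fin n → Set
IsolatedEdge G u v =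
  Adj G u v × (∀ w → Adj G u w → w ≡ v) × (∀ w → Adj G v w → w ≡ u)

InF3s : ∀ {n} → Graph n → Set
InF3s {n} G =
  (3 ≤ n)
  × (∀ u v → ¬ IsolatedEdge G u v)
  × (∀ u v → Isolated G u → Isolated G v → u ≡ v)

ColorSet : ℕ → Set₁
ColorSet k = Fin k → Set

SameSet : ∀ {k} → ColorSet k → ColorSet k → Set
SameSet A B = ∀ c → (A c → B c) × (B c → A c)

_≠ₛ_ : ∀ {k} → ColorSet k → ColorSet k → Set
A ≠ₛ B = ¬ SameSet A B

-- Proper total k-colorings (colors are the elements of Fin k,
-- i.e. k colors; this is a relabelling of {1,…,k})

record TotalColoring {n} (G : Graph n) (k : ℕ) : Set where
  field
    fv : Fin n → Fin k
    fe : Fin n → Fin n → Fin k          -- only values on edges matter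
    fe-sym      : ∀ u v → Adj G u v → fe u v ≡ fe v u
    vert-proper : ∀ u v → Adj G u v → fv u ≢ fv v
    edge-proper : ∀ u v w → Adj G u v → Adj G u w → v ≢ w → fe u v ≢ fe u w
    inc-proper  : ∀ u v → Adj G u v → fe u v ≢ fv u
open TotalColoring public

module _ {n} {G : Graph n} {k : ℕ} (f : TotalColoring G k) where
  Cset : Fin n → ColorSet k
  Cset u c = ∃[ v ] (Adj G u v × fe f u v ≡ c)

  Cang : Fin n → ColorSet k
  Cang u c = (fv f u ≡ c) ⊎ (∃[ v ] (Adj G u v × fv f v ≡ c))

  Cbr : Fin n → ColorSet k
  Cbr u c = Cset u c ⊎ (fv f u ≡ c)

  N2 : Fin n → ColorSet k
  N2 u c = Cset u c ⊎ Cang u c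

  AllDistinct : (Fin n → ColorSet k) → Set
  AllDistinct S = ∀ u v → u ≢ v → S u ≠ₛ S v

  AdjDistinct : (Fin n → ColorSet k) → Set
  AdjDistinct S = ∀ x y → Adj G x y → S x ≠ₛ S y

-- The eight conditions (C1)–(C8), indexed by the subscripts used in the paper:
-- (s) ↦ C1, (as) ↦ C2, ⟨s⟩ ↦ C3, ⟨as⟩ ↦ C4, s ↦ C5, as ↦ C6, 2s ↦ C7, 2as ↦ C8

data Kind : Set where
  par-s par-as ang-s ang-as s as 2s 2as : Kind

Sat : ∀ {n} {G : Graph n} {k} → Kind → TotalColoring G k → Set
Sat par-s  f = AllDistinct f (Cset f)
Sat par-as f = AdjDistinct f (Cset f)
Sat ang-s f = AllDistinct f (Cang f)
Sat ang-as f = AdjDistinct f (Cang f)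
Sat s   f = AllDistinct f (Cbr f)
Sat as  f = AdjDistinct f (Cbr f)
Sat 2s  f = AllDistinct f (N2 f)
Sat 2as f = AdjDistinct f (N2 f)

HasKindColoring : ∀ {n} → Graph n → Kind → ℕ → Set
HasKindColoring G κ k = Σ (TotalColoring G k) (Sat κ)

SixKinds EightKinds : List Kind
SixKinds   = par-s ∷ par-as ∷ s ∷ as ∷ 2s ∷ 2as ∷ []
EightKinds = par-s ∷ par-as ∷ ang-s ∷ ang-as ∷ s ∷ as ∷ 2s ∷ 2as ∷ []

SatAll : ∀ {n} {G : Graph n} {k} → List Kind → TotalColoring G k → Set
SatAll []       f = Data.Unit.⊤ where import Data.Unit
SatAll (κ ∷ κs) f = Sat κ f × SatAll κs f

Has6Coloring Has8Coloring : ∀ {n} → Graph n → ℕ → Set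
Has6Coloring G k = Σ (TotalColoring G k) (SatAll SixKinds)
Has8Coloring G k = Σ (TotalColoring G k) (SatAll EightKinds)

record EdgeColoring {n} (G : Graph n) (k : ℕ) : Set where
  field
    ge : Fin n → Fin n → Fin k
    ge-sym      : ∀ u v → Adj G u v → ge u v ≡ ge v u
    edge-proper : ∀ u v w → Adj G u v → Adj G u w → v ≢ w → ge u v ≢ ge u w
open EdgeColoring public

EdgeCset : ∀ {n} {G : Graph n} {k} → EdgeColoring G k → Fin n → ColorSet k
EdgeCset {G = G} g u c = ∃[ v ] (Adj G u v × ge g u v ≡ c)

HasVDEdgeColoring : ∀ {n} → Graph n → ℕ → Set
HasVDEdgeColoring G k =
  Σ (EdgeColoring G k) λ g → ∀ u v → u ≢ v → EdgeCset g u ≠ₛ EdgeCset g v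

-- "m is the least k with P k"  (the chromatic-type numbers)

IsLeast : (ℕ → Set) → ℕ → Set
IsLeast P m = P m × (∀ k → P k → m ≤ k)

-- Colour every edge by the unordered pair of its ends.  Then equal edge-colour
-- sets at distinct vertices u, v force N(u) ⊆ {v} and N(v) ⊆ {u}: either uv is
-- an isolated edge or u and v are both isolated, which 𝓕₃ₛ(n) rules out.  Put
-- a vertex-distinguishing edge colouring on the first a colours and a proper
-- vertex colouring on the last b.  Restricted to the first a colours, C, C[ ]
-- and N₂ are the edge-colour sets, so (C1),(C2),(C5)–(C8) hold; restricted to
-- the last b, C⟨ ⟩ is that of the vertex part, so (C3),(C4) are inherited from
-- a total colouring satisfying (C3).  The lower bounds hold because a colouring
-- meeting several conditions meets each of them.
module Submission where

open import Defs hiding (sym)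
open import Data.Nat using (ℕ; _≤_; _+_; _⊓_; _*_)
open import Data.Nat.Properties using (⊓-glb)
open import Data.Fin as Fin using (Fin; _↑ˡ_; _↑ʳ_; splitAt; combine)
open import Data.Fin.Properties
  using (_≤?_; ≤-antisym; ≤-total; combine-injective; splitAt-↑ˡ; splitAt-↑ʳ; ↑ˡ-injective; ↑ʳ-injective)
open import Data.Product using (Σ; _×_; ∃-syntax; _,_; proj₁; proj₂)
open import Data.Sum using (_⊎_; inj₁; inj₂)
open import Data.Empty using (⊥-elim)
open import Data.List.Membership.Propositional using (_∈_)
open import Data.List.Relation.Unary.Any using (here; there)
open import Function using (_∘_)
open import Relation.Nullary using (¬_; Dec; yes; no)
open import Relation.Binary.PropositionalEquality
  using (_≡_; _≢_; refl; sym; trans; cong; ≢-sym)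

↑ˡ≢↑ʳ : ∀ {a b} (i : Fin a) (j : Fin b) → i ↑ˡ b ≢ a ↑ʳ j
↑ˡ≢↑ʳ {a} {b} i j eq
  with trans (sym (splitAt-↑ˡ a i b)) (trans (cong (splitAt a) eq) (splitAt-↑ʳ a b j))
... | ()

adj⇒≢ : ∀ {n} (G : Graph n) {u v} → Adj G u v → u ≢ v
adj⇒≢ G {u} uv refl with trans (sym uv) (irrefl G u)
... | ()

SameSet-sym : ∀ {k} {A B : ColorSet k} → SameSet A B → SameSet B A
SameSet-sym A≈B c = proj₂ (A≈B c) , proj₁ (A≈B c)

SameSet-trans : ∀ {k} {A B C : ColorSet k} → SameSet A B → SameSet B C → SameSet A C
SameSet-trans A≈B B≈C c = proj₁ (B≈C c) ∘ proj₁ (A≈B c) , proj₂ (A≈B c) ∘ proj₂ (B≈C c)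


module _ {n : ℕ} where

  pairColorBy : (u v : Fin n) → Dec (u Fin.≤ v) → Fin (n * n)
  pairColorBy u v (yes _) = combine u v
  pairColorBy u v (no _)  = combine v u

  pairColor : Fin n → Fin n → Fin (n * n)
  pairColor u v = pairColorBy u v (u ≤? v)

  pairColorBy-comm : ∀ u v p q → pairColorBy u v p ≡ pairColorBy v u q
  pairColorBy-comm u v (yes u≤v) (yes v≤u) with ≤-antisym u≤v v≤u
  ... | refl = refl
  pairColorBy-comm u v (yes _) (no _) = refl
  pairColorBy-comm u v (no _) (yes _) = refl
  pairColorBy-comm u v (no u≰v) (no v≰u) with ≤-total u v
  ... | inj₁ u≤v = ⊥-elim (u≰v u≤v)
  ... | inj₂ v≤u = ⊥-elim (v≰u v≤u)

  pairColorBy-injective : ∀ a b c d p q → pairColorBy a b p ≡ pairColorBy c d q →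
                          (a ≡ c × b ≡ d) ⊎ (a ≡ d × b ≡ c)
  pairColorBy-injective a b c d (yes _) (yes _) eq = inj₁ (combine-injective a b c d eq)
  pairColorBy-injective a b c d (yes _) (no _)  eq = inj₂ (combine-injective a b d c eq)
  pairColorBy-injective a b c d (no _)  (yes _) eq with combine-injective b a c d eq
  ... | b≡c , a≡d = inj₂ (a≡d , b≡c)
  pairColorBy-injective a b c d (no _)  (no _)  eq with combine-injective b a d c eq
  ... | b≡d , a≡c = inj₁ (a≡c , b≡d)

  pairColor-comm : ∀ u v → pairColor u v ≡ pairColor v u
  pairColor-comm u v = pairColorBy-comm u v (u ≤? v) (v ≤? u)

  pairColor-injective : ∀ {a b c d} → pairColor a b ≡ pairColor c d →
                        (a ≡ c × b ≡ d) ⊎ (a ≡ d × b ≡ c)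
  pairColor-injective {a} {b} {c} {d} = pairColorBy-injective a b c d (a ≤? b) (c ≤? d)

  pairColor-cancelˡ : ∀ {u v w} → pairColor u v ≡ pairColor u w → v ≡ w
  pairColor-cancelˡ {u} {v} {w} eq with pairColor-injective {u} {v} {u} {w} eq
  ... | inj₁ (_ , v≡w)   = v≡w
  ... | inj₂ (u≡w , v≡u) = trans v≡u u≡w

  pairColor-otherEnd : ∀ {u x v y} → pairColor u x ≡ pairColor v y → u ≢ v → u ≡ y
  pairColor-otherEnd {u} {x} {v} {y} eq u≢v with pairColor-injective {u} {x} {v} {y} eq
  ... | inj₁ (u≡v , _) = ⊥-elim (u≢v u≡v)
  ... | inj₂ (u≡y , _) = u≡y

pairColoring : ∀ {n} (G : Graph n) → EdgeColoring G (n * n)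
pairColoring G = record
  { ge          = pairColor
  ; ge-sym      = λ u v _ → pairColor-comm u v
  ; edge-proper = λ u v w _ _ v≢w → v≢w ∘ pairColor-cancelˡ {u = u} {v} {w}
  }


Separates : ∀ {n k} → (Fin n → ColorSet k) → Set
Separates S = ∀ u v → u ≢ v → S u ≠ₛ S v

VertexDistinguishing : ∀ {n} {G : Graph n} {k} → EdgeColoring G k → Set
VertexDistinguishing g = Separates (EdgeCset g)

Separates-pullback : ∀ {n k l} {S : Fin n → ColorSet k} {T : Fin n → ColorSet l}
                     (φ : Fin l → Fin k) → (∀ u → SameSet (T u) (S u ∘ φ)) →
                     Separates T → Separates S
Separates-pullback φ T≈Sφ T-sep u v u≢v Su≈Sv =
  T-sep u v u≢v (SameSet-trans (T≈Sφ u) (SameSet-trans (Su≈Sv ∘ φ) (SameSet-sym (T≈Sφ v))))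

Separates⇒adjacent : ∀ {n} {G : Graph n} {k} (f : TotalColoring G k) {S : Fin n → ColorSet k} →
                     Separates S → AdjDistinct f S
Separates⇒adjacent {G = G} f S-sep x y xy = S-sep x y (adj⇒≢ G xy)

pairColoring-vertexDistinguishing : ∀ {n} (G : Graph n) → InF3s G →
                                    VertexDistinguishing (pairColoring G)
pairColoring-vertexDistinguishing G (_ , noIsolatedEdge , isolated-unique) u v u≢v same =
  u≢v (isolated-unique u v u-isolated v-isolated)
  where
  EC = EdgeCset (pairColoring G)

  onlyNeighbour : ∀ {u v} → u ≢ v → SameSet (EC u) (EC v) → ∀ x → Adj G u x → x ≡ v
  onlyNeighbour u≢v same x ux with proj₁ (same _) (x , ux , refl)
  ... | y , vy , vy≡ux = sym (pairColor-otherEnd vy≡ux (≢-sym u≢v))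

  u-isolated : Isolated G u
  u-isolated x ux with onlyNeighbour u≢v same x ux
  ... | refl = noIsolatedEdge u x
    (ux , onlyNeighbour u≢v same , onlyNeighbour (≢-sym u≢v) (SameSet-sym same))

  v-isolated : Isolated G v
  v-isolated y vy with proj₂ (same _) (y , vy , refl)
  ... | x , ux , _ = u-isolated x ux


module Join {n} {G : Graph n} {a b : ℕ} (g : EdgeColoring G a)
            (c : Fin n → Fin b) (c-proper : ∀ u v → Adj G u v → c u ≢ c v) where

  join : TotalColoring G (a + b)
  join = record
    { fv          = λ u → a ↑ʳ c u
    ; fe          = λ u v → ge g u v ↑ˡ b
    ; fe-sym      = λ u v uv → cong (_↑ˡ b) (ge-sym g u v uv)
    ; vert-proper = λ u v uv → c-proper u v uv ∘ ↑ʳ-injective a _ _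
    ; edge-proper = λ u v w uv uw v≢w →
        EdgeColoring.edge-proper g u v w uv uw v≢w ∘ ↑ˡ-injective b _ _
    ; inc-proper  = λ u v _ → ↑ˡ≢↑ʳ _ _
    }

  ClosedNbhdColors : Fin n → ColorSet b
  ClosedNbhdColors u d = (c u ≡ d) ⊎ ∃[ v ] (Adj G u v × c v ≡ d)

  Cset-edgePart : ∀ u → SameSet (EdgeCset g u) (Cset join u ∘ (_↑ˡ b))
  Cset-edgePart u i = (λ (v , uv , eq) → v , uv , cong (_↑ˡ b) eq)
                    , (λ (v , uv , eq) → v , uv , ↑ˡ-injective b _ _ eq)

  Cang-vertexPart : ∀ u → SameSet (ClosedNbhdColors u) (Cang join u ∘ (a ↑ʳ_))
  Cang-vertexPart u d =
      (λ { (inj₁ eq)            → inj₁ (cong (a ↑ʳ_) eq)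
         ; (inj₂ (v , uv , eq)) → inj₂ (v , uv , cong (a ↑ʳ_) eq) })
    , (λ { (inj₁ eq)            → inj₁ (↑ʳ-injective a _ _ eq)
         ; (inj₂ (v , uv , eq)) → inj₂ (v , uv , ↑ʳ-injective a _ _ eq) })

  Cang-noEdgeColors : ∀ u i → ¬ Cang join u (i ↑ˡ b)
  Cang-noEdgeColors u i (inj₁ eq)           = ↑ˡ≢↑ʳ i _ (sym eq)
  Cang-noEdgeColors u i (inj₂ (_ , _ , eq)) = ↑ˡ≢↑ʳ i _ (sym eq)

  Cbr-edgePart : ∀ u → SameSet (EdgeCset g u) (Cbr join u ∘ (_↑ˡ b))
  Cbr-edgePart u = SameSet-trans (Cset-edgePart u) λ i →
    inj₁ , λ { (inj₁ x) → x ; (inj₂ eq) → ⊥-elim (↑ˡ≢↑ʳ i _ (sym eq)) }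

  N2-edgePart : ∀ u → SameSet (EdgeCset g u) (N2 join u ∘ (_↑ˡ b))
  N2-edgePart u = SameSet-trans (Cset-edgePart u) λ i →
    inj₁ , λ { (inj₁ x) → x ; (inj₂ x) → ⊥-elim (Cang-noEdgeColors u i x) }

  join-six : VertexDistinguishing g → SatAll SixKinds join
  join-six g-vd =
      Cset-sep , Separates⇒adjacent join Cset-sep
    , Cbr-sep  , Separates⇒adjacent join Cbr-sep
    , N2-sep   , Separates⇒adjacent join N2-sep
    , _
    where
    Cset-sep = Separates-pullback (_↑ˡ b) Cset-edgePart g-vd
    Cbr-sep  = Separates-pullback (_↑ˡ b) Cbr-edgePart g-vd
    N2-sep   = Separates-pullback (_↑ˡ b) N2-edgePart g-vd

  join-eight : VertexDistinguishing g → Separates ClosedNbhdColors → SatAll EightKinds join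
  join-eight g-vd c-sep with join-six g-vd
  ... | c1 , c2 , c5 , c6 , c7 , c8 , _ =
    c1 , c2 , Cang-sep , Separates⇒adjacent join Cang-sep , c5 , c6 , c7 , c8 , _
    where
    Cang-sep = Separates-pullback (a ↑ʳ_) Cang-vertexPart c-sep


IsLeast-mono : ∀ {P Q : ℕ → Set} {m m′} → (∀ {k} → P k → Q k) →
               IsLeast P m → IsLeast Q m′ → m′ ≤ m
IsLeast-mono P⇒Q (Pm , _) (_ , Q-least) = Q-least _ (P⇒Q Pm)

SatAll-∈ : ∀ {n} {G : Graph n} {k} {f : TotalColoring G k} {κ κs} →
           κ ∈ κs → SatAll κs f → Sat κ f
SatAll-∈ (here refl) (sat , _)  = sat
SatAll-∈ (there κ∈)  (_ , sats) = SatAll-∈ κ∈ sats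

SatAll⇒HasKindColoring : ∀ {n} {G : Graph n} {k κ κs} → κ ∈ κs →
                         Σ (TotalColoring G k) (SatAll κs) → HasKindColoring G κ k
SatAll⇒HasKindColoring κ∈ (f , sats) = f , SatAll-∈ κ∈ sats

edgeColoring : ∀ {n} {G : Graph n} {k} → TotalColoring G k → EdgeColoring G k
edgeColoring h = record
  { ge = fe h ; ge-sym = fe-sym h ; edge-proper = TotalColoring.edge-proper h }

par-s⇒VDEdgeColoring : ∀ {n} {G : Graph n} {k} →
                       HasKindColoring G par-s k → HasVDEdgeColoring G k
par-s⇒VDEdgeColoring (h , C1) = edgeColoring h , C1

has6Coloring : ∀ {n} (G : Graph n) → InF3s G → Has6Coloring G (n * n + n)
has6Coloring G G∈F3s = join , join-six (pairColoring-vertexDistinguishing G G∈F3s)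
  where open Join (pairColoring G) (λ u → u) (λ u v → adj⇒≢ G)

has8Coloring : ∀ {n} {G : Graph n} {a b} →
               HasVDEdgeColoring G a → HasKindColoring G ang-s b → Has8Coloring G (a + b)
has8Coloring (g , g-vd) (h , C3) = join , join-eight g-vd C3
  where open Join g (fv h) (vert-proper h)

lemma3 : ∀ {n} (G : Graph n) → InF3s G →
    ( (∃[ k ] Has6Coloring G k)
      × (∀ λ′ → λ′ ∈ SixKinds → ∀ m₆ mλ →
           IsLeast (Has6Coloring G) m₆ → IsLeast (HasKindColoring G λ′) mλ → mλ ≤ m₆) )
    ×
    ( ∀ m₈ → IsLeast (Has8Coloring G) m₈ →
        (∀ ε → ε ∈ EightKinds → ∀ mε →
           IsLeast (HasKindColoring G ε) mε → mε ≤ m₈)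
        × (∀ m′s m⟨s⟩ m₍s₎ →
             IsLeast (HasVDEdgeColoring G) m′s →
             IsLeast (HasKindColoring G ang-s) m⟨s⟩ →
             IsLeast (HasKindColoring G par-s) m₍s₎ →
             m₈ ≤ (m′s + m⟨s⟩) ⊓ (m₍s₎ + m⟨s⟩)) )
lemma3 {n} G G∈F3s =
    ( (n * n + n , has6Coloring G G∈F3s)
    , λ λ′ λ′∈ m₆ mλ → IsLeast-mono (SatAll⇒HasKindColoring λ′∈) )
  , λ m₈ m₈-least →
    ( (λ ε ε∈ mε → IsLeast-mono (SatAll⇒HasKindColoring ε∈) m₈-least)
    , λ m′s m⟨s⟩ m₍s₎ (g , _) (h , _) (h′ , _) →
        ⊓-glb (proj₂ m₈-least _ (has8Coloring g h))
              (proj₂ m₈-least _ (has8Coloring (par-s⇒VDEdgeColoring h′) h)) )
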